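{- Let $N=(S,T,F,M_0)$ be a binary-conflict-free net, $t\in T$, $\sigma,\rho\in T^*$ such that $t$ does not occur in $\rho$, and $\sigma t,\sigma\rho\in\mathrm{FS}(N)$. Then $\sigma t\rho,\sigma\rho t\in\mathrm{FS}(N)$ and $\sigma t\rho\equiv_0^*\sigma\rho t$.
   Context: A net is $N=(S,T,F,M_0)$ with $S,T$ disjoint, $F:(S\times T)\cup(T\times S)\to\mathbb{N}$, $M_0:S\to\mathbb{N}$, each transition having finitely many and at least one preplace and finitely many postplaces. ${}^\bullet x(y)=F(y,x)$, $x^\bullet(y)=F(x,y)$ (multisets), extended additively to finite multisets. For markings $M,M'$ and finite non-empty multiset $G$ of transitions, $M\xrightarrow{G}M'$ iff ${}^\bullet G\le M$ and $M'=(M-{}^\bullet G)+G^\bullet$. For a finite or infinite word $\sigma=t_1t_2\cdots$, $M\xrightarrow{\sigma}$ means $M\xrightarrow{\{t_1\}}M_1\xrightarrow{\{t_2\}}\cdots$. $\mathrm{FS}^\infty(N)$: words with $M_0\xrightarrow{\sigma}$; $\mathrm{FS}(N)$: finite ones; reachable markings are those $M$ with $M_0\xrightarrow{\sigma}M$ for some finite $\sigma$. A finite non-empty multiset $G$ of transitions is in semantic conflict in $M$ iff not $M\xrightarrow{G}$ but $M\xrightarrow{G\restriction\{t\}}$ for every $t\in G$; $N$ is binary-conflict-free iff no $G$ with $|G|=2$ is in semantic conflict in any reachable marking. For $\sigma,\rho\in\mathrm{FS}^\infty(N)$, $\sigma\equiv_0\rho$ iff $\sigma=\alpha tu\beta$,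 $\rho=\alpha ut\beta$ and $M_0\xrightarrow{\alpha}M\xrightarrow{\{t,u\}}$ for some $M$; $\equiv_0^*$ is its reflexive transitive closure. -}

module Defs where

open import Data.Nat using (ℕ; zero; suc; _+_; _*_; _∸_; _≤_; _<_)
open import Data.List using (List; []; _∷_; _++_; map; [_])
open import Data.Nat.ListAction using (sum)
open import Data.List.Membership.Propositional using (_∈_; _∉_)
open import Data.Product using (Σ; ∃; ∃-syntax; _×_; _,_)
open import Relation.Binary.PropositionalEquality using (_≡_; _≢_)
open import Relation.Nullary using (¬_)
open import Relation.Binary.Construct.Closure.ReflexiveTransitive using (Star)

-- A net N = (S, T, F, M₀).  S and T are separate types (hence disjoint).
-- The flow function F : (S×T) ∪ (T×S) → ℕ is given by its two components.
record Net : Set₁ where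
  field
    S   : Set
    T   : Set
    Fst : S → T → ℕ
    Fts : T → S → ℕ
    M₀  : S → ℕ
    prePlaces     : T → List S
    prePlaces-ok  : ∀ t s → 0 < Fst s t → s ∈ prePlaces t
    nonemptyPre   : ∀ t → ∃[ s ] (0 < Fst s t)
    postPlaces    : T → List S
    postPlaces-ok : ∀ t s → 0 < Fts t s → s ∈ postPlaces t

module _ (N : Net) where
  open Net N

  Marking : Set
  Marking = S → ℕ

  -- Finite multisets of transitions are represented by lists (order irrelevant).
  MSet : Set
  MSet = List T

  pre : MSet → S → ℕ
  pre G s = sum (map (λ t → Fst s t) G)

  post : MSet → S → ℕ
  post G s = sum (map (λ t → Fts t s) G)

  Enabled : Marking → MSet → Set
  Enabled M G = ∀ s → pre G s ≤ M s

  Step : Marking → MSet → Marking → Set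
  Step M G M' = Enabled M G × (∀ s → M' s ≡ (M s ∸ pre G s) + post G s)

  data Run : Marking → List T → Marking → Set where
    done : ∀ {M M'} → (∀ s → M s ≡ M' s) → Run M [] M'
    step : ∀ {M M₁ M' t σ} → Step M [ t ] M₁ → Run M₁ σ M' → Run M (t ∷ σ) M'

  FS : List T → Set
  FS σ = ∃[ M ] Run M₀ σ M

  Reachable : Marking → Set
  Reachable M = ∃[ σ ] Run M₀ σ M

  data Restrict (t : T) : MSet → MSet → Set where
    r-nil  : Restrict t [] []
    r-keep : ∀ {x G H} → x ≡ t → Restrict t G H → Restrict t (x ∷ G) (x ∷ H)
    r-drop : ∀ {x G H} → x ≢ t → Restrict t G H → Restrict t (x ∷ G) H

  SemConflict : Marking → MSet → Set
  SemConflict M G =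
    ¬ Enabled M G × (∀ t → t ∈ G → ∀ H → Restrict t G H → Enabled M H)

  BinaryConflictFree : Set
  BinaryConflictFree = ∀ M → Reachable M → ∀ t u → ¬ SemConflict M (t ∷ u ∷ [])

  data _≡₀_ (σ ρ : List T) : Set where
    swap : FS σ → FS ρ →
           (α β : List T) (t u : T) →
           σ ≡ α ++ t ∷ u ∷ β → ρ ≡ α ++ u ∷ t ∷ β →
           (∃[ M ] (Run M₀ α M × Enabled M (t ∷ u ∷ []))) →
           σ ≡₀ ρ

  _≡₀*_ : List T → List T → Set
  _≡₀*_ = Star _≡₀_

{-# OPTIONS --safe #-}
-- Induction on ρ = u ∷ ρ′.  After σ both t and u are enabled, so binary
-- conflict-freeness makes {t, u} concurrently enabled.  Hence σut is firable,
-- the induction hypothesis for the prefix σu moves t across ρ′, and finally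
-- σutρ′ ≡₀ σtuρ′ by one swap, which is firable because firing the concurrent
-- pair in either order reaches the same marking.
module Submission where

open import Defs
open import Data.List using (List; []; _∷_; _++_; [_])
open import Data.List.Membership.Propositional using (_∈_; _∉_)
open import Data.List.Relation.Unary.Any using (here; there)
open import Data.List.Properties using (++-assoc)
open import Data.Product using (_×_; _,_; ∃-syntax)
open import Data.Nat using (_+_; _∸_; _≤_; _≤?_)
open import Data.Nat.Properties
  using (+-comm; +-identityʳ; +-assoc; +-∸-comm; ∸-+-assoc; m+n≤o⇒m≤o∸n; m≤m+n; ≤-trans)
open import Data.Empty using (⊥-elim)
open import Function using (_∘_)
open import Relation.Nullary using (yes; no)
open import Relation.Binary.PropositionalEquality
  using (_≡_; _≢_; _≗_; refl; sym; trans; cong; subst; cong₂; module ≡-Reasoning)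
open import Relation.Binary.Construct.Closure.ReflexiveTransitive using (ε; _◅_)

∸-+-≤ : ∀ {m a c} d → a + c ≤ m → a ≤ m ∸ c + d
∸-+-≤ {m} {a} {c} d a+c≤m = ≤-trans (m+n≤o⇒m≤o∸n a a+c≤m) (m≤m+n (m ∸ c) d)

∸-+-∸-+ : ∀ m a b c d → a + c ≤ m → (m ∸ c + d) ∸ a + b ≡ m ∸ (c + a) + (d + b)
∸-+-∸-+ m a b c d a+c≤m = begin
  (m ∸ c + d) ∸ a + b   ≡⟨ cong (_+ b) (+-∸-comm d (m+n≤o⇒m≤o∸n a a+c≤m)) ⟩
  (m ∸ c ∸ a) + d + b   ≡⟨ cong (λ k → k + d + b) (∸-+-assoc m c a) ⟩
  m ∸ (c + a) + d + b   ≡⟨ +-assoc (m ∸ (c + a)) d b ⟩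
  m ∸ (c + a) + (d + b) ∎
  where open ≡-Reasoning

∸-+-interchange : ∀ m a b c d → a + c ≤ m →
                  (m ∸ c + d) ∸ a + b ≡ (m ∸ a + b) ∸ c + d
∸-+-interchange m a b c d a+c≤m = begin
  (m ∸ c + d) ∸ a + b   ≡⟨ ∸-+-∸-+ m a b c d a+c≤m ⟩
  m ∸ (c + a) + (d + b) ≡⟨ cong₂ (λ x y → m ∸ x + y) (+-comm c a) (+-comm d b) ⟩
  m ∸ (a + c) + (b + d) ≡⟨ sym (∸-+-∸-+ m c d a b (subst (_≤ m) (+-comm a c) a+c≤m)) ⟩
  (m ∸ a + b) ∸ c + d   ∎
  where open ≡-Reasoning

module _ {N : Net} where
  open Net N

  fire : Marking N → List T → Marking N
  fire M G s = M s ∸ pre N G s + post N G s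

  Step-fire : ∀ {M} G → Enabled N M G → Step N M G (fire M G)
  Step-fire _ en = en , λ _ → refl

  Enabled-resp : ∀ {M M′} G → M ≗ M′ → Enabled N M G → Enabled N M′ G
  Enabled-resp G M≗M′ en s = subst (pre N G s ≤_) (M≗M′ s) (en s)

  Run-respˡ : ∀ {M M′ K} σ → M ≗ M′ → Run N M σ K → Run N M′ σ K
  Run-respˡ [] M≗M′ (done M≗K) = done (λ s → trans (sym (M≗M′ s)) (M≗K s))
  Run-respˡ (t ∷ σ) M≗M′ (step (en , eq) r) =
    step (Enabled-resp [ t ] M≗M′ en ,
          λ s → trans (eq s) (cong (λ k → k ∸ pre N [ t ] s + post N [ t ] s) (M≗M′ s)))
         r

  Run-deterministic : ∀ {M K K′} σ → Run N M σ K → Run N M σ K′ → K ≗ K′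
  Run-deterministic [] (done M≗K) (done M≗K′) s = trans (sym (M≗K s)) (M≗K′ s)
  Run-deterministic (t ∷ σ) (step (_ , eq) r) (step (_ , eq′) r′) =
    Run-deterministic σ r (Run-respˡ σ (λ s → trans (eq′ s) (sym (eq s))) r′)

  Run-++⁻ : ∀ {M M′} σ τ → Run N M (σ ++ τ) M′ → ∃[ K ] (Run N M σ K × Run N K τ M′)
  Run-++⁻ [] τ r = _ , done (λ _ → refl) , r
  Run-++⁻ (t ∷ σ) τ (step st r) with Run-++⁻ σ τ r
  ... | K , r₁ , r₂ = K , step st r₁ , r₂

  Run-++⁺ : ∀ {M K M′} σ τ → Run N M σ K → Run N K τ M′ → Run N M (σ ++ τ) M′
  Run-++⁺ [] τ (done M≗K) r = Run-respˡ τ (sym ∘ M≗K) r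
  Run-++⁺ (t ∷ σ) τ (step st r₁) r₂ = step st (Run-++⁺ σ τ r₁ r₂)

  Run-++-∷⇒Enabled : ∀ {M K M′ t} σ τ → Run N M (σ ++ t ∷ τ) M′ → Run N M σ K → Enabled N K [ t ]
  Run-++-∷⇒Enabled {t = t} σ τ r σ↝K with Run-++⁻ σ (t ∷ τ) r
  ... | _ , σ↝K′ , step (en , _) _ = Enabled-resp [ t ] (Run-deterministic σ σ↝K′ σ↝K) en

  pre-pair : ∀ t u s → pre N (t ∷ u ∷ []) s ≡ pre N [ t ] s + pre N [ u ] s
  pre-pair t u s = cong (_+ pre N [ u ] s) (sym (+-identityʳ (Fst s t)))

  Enabled-pair⁻ : ∀ {M t u} → Enabled N M (t ∷ u ∷ []) → ∀ s → pre N [ t ] s + pre N [ u ] s ≤ M s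
  Enabled-pair⁻ {M} {t} {u} en s = subst (_≤ M s) (pre-pair t u s) (en s)

  Enabled-pair-comm : ∀ {M t u} → Enabled N M (t ∷ u ∷ []) → Enabled N M (u ∷ t ∷ [])
  Enabled-pair-comm {M} {t} {u} en s =
    subst (_≤ M s) (trans (+-comm (pre N [ t ] s) (pre N [ u ] s)) (sym (pre-pair u t s))) (Enabled-pair⁻ en s)

  Enabled-pair-fst : ∀ {M t u} → Enabled N M (t ∷ u ∷ []) → Enabled N M [ t ]
  Enabled-pair-fst {u = u} en s = ≤-trans (m≤m+n _ (pre N [ u ] s)) (Enabled-pair⁻ en s)

  Enabled-after-fire : ∀ {M t u} → Enabled N M (t ∷ u ∷ []) → Enabled N (fire M [ u ]) [ t ]
  Enabled-after-fire {u = u} en s = ∸-+-≤ (post N [ u ] s) (Enabled-pair⁻ en s)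

  Run-pair : ∀ {M t u} → Enabled N M (t ∷ u ∷ []) → Run N M (u ∷ t ∷ []) (fire (fire M [ u ]) [ t ])
  Run-pair {t = t} {u} en = step (Step-fire [ u ] (Enabled-pair-fst (Enabled-pair-comm en)))
                               (step (Step-fire [ t ] (Enabled-after-fire en)) (done λ _ → refl))

  Run-swap : ∀ {M M′ t u} τ → Enabled N M (t ∷ u ∷ []) → Run N M (u ∷ t ∷ τ) M′ → Run N M (t ∷ u ∷ τ) M′
  Run-swap {M} {t = t} {u} τ en (step (_ , X≡) (step {M₁ = Y} (_ , Y≡) r)) =
    step (Step-fire [ t ] (Enabled-pair-fst en))
      (step (Enabled-after-fire (Enabled-pair-comm en) , Y≡′) r)
    where
    Y≡′ : ∀ s → Y s ≡ fire (fire M [ t ]) [ u ] s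
    Y≡′ s = trans (Y≡ s) (trans (cong (λ k → k ∸ pre N [ t ] s + post N [ t ] s) (X≡ s))
                    (∸-+-interchange (M s) (pre N [ t ] s) (post N [ t ] s) (pre N [ u ] s) (post N [ u ] s)
                      (Enabled-pair⁻ en s)))

  Run-swap-after : ∀ {M K M′ t u} σ τ → Run N M σ K → Enabled N K (t ∷ u ∷ []) →
                   Run N M (σ ++ u ∷ t ∷ τ) M′ → Run N M (σ ++ t ∷ u ∷ τ) M′
  Run-swap-after {t = t} {u} σ τ σ↝K en r with Run-++⁻ σ (u ∷ t ∷ τ) r
  ... | K′ , σ↝K′ , rest =
    Run-++⁺ σ (t ∷ u ∷ τ) σ↝K′
      (Run-swap τ (Enabled-resp (t ∷ u ∷ []) (sym ∘ Run-deterministic σ σ↝K′ σ↝K) en) rest)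

  Restrict-pair : ∀ {t u x H} → t ≢ u → x ∈ t ∷ u ∷ [] → Restrict N x (t ∷ u ∷ []) H → H ≡ [ x ]
  Restrict-pair t≢u (here refl)         (r-keep _ (r-drop _ r-nil)) = refl
  Restrict-pair t≢u (here refl)         (r-keep _ (r-keep u≡t _))   = ⊥-elim (t≢u (sym u≡t))
  Restrict-pair t≢u (here refl)         (r-drop t≢t _)              = ⊥-elim (t≢t refl)
  Restrict-pair t≢u (there (here refl)) (r-keep t≡u _)               = ⊥-elim (t≢u t≡u)
  Restrict-pair t≢u (there (here refl)) (r-drop _ (r-keep _ r-nil))  = refl
  Restrict-pair t≢u (there (here refl)) (r-drop _ (r-drop u≢u _))    = ⊥-elim (u≢u refl)

  -- Enabled quantifies over all places and need not be decidable, so the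
  -- semantic conflict is refuted at one place at a time.
  Enabled-pair⁺ : ∀ {M t u} → BinaryConflictFree N → Reachable N M → t ≢ u →
                  Enabled N M [ t ] → Enabled N M [ u ] → Enabled N M (t ∷ u ∷ [])
  Enabled-pair⁺ {M} {t} {u} bcf reach t≢u en-t en-u s with pre N (t ∷ u ∷ []) s ≤? M s
  ... | yes ok = ok
  ... | no ¬ok = ⊥-elim (bcf M reach t u ((λ en → ¬ok (en s)) , singletons-enabled))
    where
    singletons-enabled : ∀ x → x ∈ t ∷ u ∷ [] → ∀ H → Restrict N x (t ∷ u ∷ []) H → Enabled N M H
    singletons-enabled x x∈ H r rewrite Restrict-pair t≢u x∈ r with x∈
    ... | here refl         = en-t
    ... | there (here refl) = en-u

  FS-++-∷⇒Enabled-pair : ∀ {t u} σ τ τ′ → BinaryConflictFree N → t ≢ u →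
                         FS N (σ ++ t ∷ τ) → FS N (σ ++ u ∷ τ′) →
                         ∃[ M ] (Run N M₀ σ M × Enabled N M (t ∷ u ∷ []))
  FS-++-∷⇒Enabled-pair σ τ τ′ bcf t≢u (_ , σt↝) (_ , σu↝) with Run-++⁻ σ _ σu↝
  ... | M , σ↝M , _ =
    M , σ↝M , Enabled-pair⁺ bcf (σ , σ↝M) t≢u
                  (Run-++-∷⇒Enabled σ τ σt↝ σ↝M) (Run-++-∷⇒Enabled σ τ′ σu↝ σ↝M)

lemma8 : (N : Net) → BinaryConflictFree N →
         (t : Net.T N) (σ ρ : List (Net.T N)) →
         t ∉ ρ →
         FS N (σ ++ t ∷ []) → FS N (σ ++ ρ) →
         (FS N (σ ++ t ∷ ρ) × FS N (σ ++ ρ ++ t ∷ []))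
           × _≡₀*_ N (σ ++ t ∷ ρ) (σ ++ ρ ++ t ∷ [])
lemma8 N bcf t σ [] _ σt _ = (σt , σt) , ε
lemma8 N bcf t σ (u ∷ ρ) t∉uρ σt σuρ
  with FS-++-∷⇒Enabled-pair σ [] ρ bcf (t∉uρ ∘ here) σt σuρ
... | M , σ↝M , tu
  with lemma8 N bcf t (σ ++ [ u ]) ρ (t∉uρ ∘ there)
         (subst (FS N) (sym (++-assoc σ [ u ] [ t ])) (_ , Run-++⁺ σ (u ∷ t ∷ []) σ↝M (Run-pair tu)))
         (subst (FS N) (sym (++-assoc σ [ u ] ρ)) σuρ)
... | (σutρ , σuρt) , utρ≡₀*uρt
  rewrite ++-assoc σ [ u ] (t ∷ ρ) | ++-assoc σ [ u ] (ρ ++ t ∷ [])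
  with σutρ
... | E , σutρ↝ =
  (σtuρ , σuρt) , swap σtuρ (E , σutρ↝) σ ρ t u refl refl (M , σ↝M , tu) ◅ utρ≡₀*uρt
  where
  σtuρ : FS N (σ ++ t ∷ u ∷ ρ)
  σtuρ = E , Run-swap-after σ ρ σ↝M tu σutρ↝
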